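{- For every finite simple graph $G(V,E)$, the set of all permutational $1$-$11$-representations of $G$ (words over $V$) is a regular language over $V$.
   Context: For a word $w$ and letters $x,y$, $w_{\{x,y\}}$ denotes the word obtained from $w$ by deleting all letters other than $x$ and $y$. A word $w\in V^{+}$ is a $1$-$11$-representation of a graph $G(V,E)$ if for all distinct $x,y\in V$: $x,y$ are adjacent in $G$ iff $w_{\{x,y\}}$ contains at most one factor of the form $xx$ or $yy$ in total (equivalently, non-adjacent iff $w_{\{x,y\}}$ contains at least two occurrences of $xx$, or at least two of $yy$, or at least one of each). A $1$-$11$-representation is permutational if it is a concatenation of one or more permutations of $V$ (words in which each vertex of $V$ occurs exactly once). -}

module Defs where

open import Data.Nat using (ℕ; zero; suc; _+_; _≤_)
open import Data.Fin using (Fin; _≟_)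
open import Data.Bool using (Bool; true; false; if_then_else_; _∧_; _∨_)
open import Data.List using (List; []; _∷_; concat; foldl; allFin)
open import Data.Product using (Σ; _×_)
open import Relation.Nullary using (¬_; does)
open import Relation.Binary.PropositionalEquality using (_≡_; _≢_)
open import Data.List.Relation.Binary.Permutation.Propositional using (_↭_)
open import Data.List.Relation.Unary.All using (All)
open import Function.Bundles using (_⇔_)

record SimpleGraph (n : ℕ) : Set where
  field
    adj    : Fin n → Fin n → Bool
    sym    : ∀ x y → adj x y ≡ adj y x
    irrefl : ∀ x → adj x x ≡ false
open SimpleGraph public

restrict : ∀ {n} → Fin n → Fin n → List (Fin n) → List (Fin n)
restrict x y [] = []
restrict x y (z ∷ w) =
  if does (z ≟ x) ∨ does (z ≟ y) then z ∷ restrict x y w else restrict x y w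

-- number of occurrences of the factor xx in a word (occurrences counted by
-- starting position, so xxx contains two occurrences).
countSq : ∀ {n} → Fin n → List (Fin n) → ℕ
countSq x [] = 0
countSq x (a ∷ []) = 0
countSq x (a ∷ b ∷ w) =
  (if does (a ≟ x) ∧ does (b ≟ x) then 1 else 0) + countSq x (b ∷ w)

NonEmpty : ∀ {A : Set} → List A → Set
NonEmpty w = ¬ (w ≡ [])

Is1-11-Rep : ∀ {n} → SimpleGraph n → List (Fin n) → Set
Is1-11-Rep {n} G w =
  NonEmpty w ×
  (∀ (x y : Fin n) → x ≢ y →
     (adj G x y ≡ true ⇔ countSq x (restrict x y w) + countSq y (restrict x y w) ≤ 1))

IsPermutational : ∀ {n} → List (Fin n) → Set
IsPermutational {n} w =
  Σ (List (List (Fin n))) λ ps →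
    NonEmpty ps × All (λ p → p ↭ allFin n) ps × concat ps ≡ w

IsPermutational1-11-Rep : ∀ {n} → SimpleGraph n → List (Fin n) → Set
IsPermutational1-11-Rep G w = IsPermutational w × Is1-11-Rep G w

record DFA (A : Set) : Set where
  field
    states : ℕ
    start  : Fin states
    δ      : Fin states → A → Fin states
    accept : Fin states → Bool
open DFA public

Accepts : ∀ {A} → DFA A → List A → Set
Accepts M w = accept M (foldl (δ M) (start M) w) ≡ true

IsRegular : ∀ {A : Set} → (List A → Set) → Set
IsRegular {A} L = Σ (DFA A) λ M → ∀ w → L w ⇔ Accepts M w

module Submission where

-- A permutational 1-11-representation is a word in the intersection of finitely many
-- languages: concatenations of permutations of V, non-empty words, and, for each pair
-- x ≠ y, the words w for which "w_{x,y} has at most one square" agrees with adjacency.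
-- Each is recognised by a finite automaton: the first remembers the unfinished block,
-- which is shorter than |V|, and rejects as soon as a completed block is not a
-- permutation; the last remembers the last letter of w_{x,y} and the number of squares
-- xx, yy seen so far, saturated at 2.  A product of finitely many automata is finite.

open import Level using (0ℓ)
open import Data.Bool as Bool using (Bool; true; false; if_then_else_; _∧_; _∨_)
open import Data.Fin as Fin using (Fin; zero; suc; toℕ; combine; remQuot)
open import Data.Fin.Properties using (remQuot-combine; all?)
open import Data.List using (List; []; _∷_; _++_; [_]; _∷ʳ_; length; foldl; concat; allFin; last; initLast; _∷ʳ′_)
open import Data.List.Membership.Propositional using (_∈_)
open import Data.List.Membership.Propositional.Properties using (∈-allFin)
open import Data.List.Membership.Propositional.Properties.WithK using (unique∧set⇒bag)
import Data.List.Membership.DecPropositional as DecMembership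
import Data.List.Properties as ListP
open import Data.List.Properties using (++-identityʳ; ++-assoc; length-++; length-++-≤ˡ; length-tabulate; foldl-∷ʳ; foldl-++)
open import Data.List.Relation.Binary.BagAndSetEquality using (∼bag⇒↭)
open import Data.List.Relation.Binary.Permutation.Propositional using (_↭_; ↭⇒↭ₛ; ↭-sym)
open import Data.List.Relation.Binary.Permutation.Propositional.Properties using (∈-resp-↭; ↭-length)
open import Data.List.Relation.Binary.Permutation.Setoid.Properties using (Unique-resp-↭)
open import Data.List.Relation.Unary.All using (All; []; _∷_)
open import Data.List.Relation.Unary.Unique.Propositional using (Unique)
open import Data.List.Relation.Unary.Unique.Propositional.Properties using (allFin⁺)
import Data.List.Relation.Unary.Unique.DecPropositional as DecUnique
open import Data.Maybe using (Maybe; nothing; just; maybe′)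
import Data.Maybe.Properties as MaybeP
open import Data.Maybe.Relation.Unary.All as Maybe using (just; nothing)
open import Data.Nat as ℕ using (ℕ; zero; suc; _+_; _*_; _≤_; _<_; z≤n; s≤s; _<?_)
open import Data.Nat.Properties
  using (<⇒≢; <⇒≤; ≤-<-trans; m<m+n; +-identityʳ; +-assoc; +-commutativeSemigroup)
open import Algebra.Properties.CommutativeSemigroup +-commutativeSemigroup using (interchange)
open import Data.Product using (Σ; _×_; _,_; proj₁)
open import Data.Product.Function.NonDependent.Propositional using (_×-⇔_)
open import Data.Unit using (⊤; tt)
open import Function.Bundles using (_⇔_; mk⇔; Equivalence)
import Function.Properties.Equivalence as ⇔
open import Relation.Binary.PropositionalEquality
  using (_≡_; _≢_; refl; cong; cong₂; trans; sym; subst; setoid; module ≡-Reasoning)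
open import Relation.Nullary using (Dec; yes; no; does; contradiction)
import Relation.Nullary.Decidable as Dec
open import Relation.Nullary.Decidable using (_×-dec_; _→-dec_; ¬?)
open import Relation.Unary using (Pred; U; _⟨×⟩_; _∩_; ⋂; _⊆_; _≐_; Decidable)

open import Defs hiding (sym; irrefl)

-- Only elements satisfying P need to be decoded correctly; this is how a type such as
-- List, restricted to bounded lengths, fits into finitely many codes.
record Encoding (S : Set) (P : Pred S 0ℓ) : Set where
  field
    size          : ℕ
    encode        : S → Fin size
    decode        : Fin size → S
    decode-encode : ∀ {s} → P s → decode (encode s) ≡ s
open Encoding

encoding-⊆ : ∀ {S} {P Q : Pred S 0ℓ} → Q ⊆ P → Encoding S P → Encoding S Q
encoding-⊆ Q⊆P E = record
  { size = size E ; encode = encode E ; decode = decode E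
  ; decode-encode = λ q → decode-encode E (Q⊆P q) }

⊤-encoding : Encoding ⊤ U
⊤-encoding = record { size = 1 ; encode = λ _ → zero ; decode = λ _ → tt ; decode-encode = λ _ → refl }

Fin-encoding : ∀ k → Encoding (Fin k) U
Fin-encoding k = record { size = k ; encode = λ i → i ; decode = λ i → i ; decode-encode = λ _ → refl }

Bool-encoding : Encoding Bool U
Bool-encoding = record { size = 2 ; encode = encode′ ; decode = decode′ ; decode-encode = λ {b} _ → inverse b }
  where
  encode′ : Bool → Fin 2
  encode′ false = zero
  encode′ true  = suc zero
  decode′ : Fin 2 → Bool
  decode′ zero    = false
  decode′ (suc _) = true
  inverse : ∀ b → decode′ (encode′ b) ≡ b
  inverse false = refl
  inverse true  = refl

×-encoding : ∀ {S T P Q} → Encoding S P → Encoding T Q → Encoding (S × T) (P ⟨×⟩ Q)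
×-encoding E F = record
  { size   = size E * size F
  ; encode = λ (s , t) → combine (encode E s) (encode F t)
  ; decode = λ i → let (j , k) = remQuot (size F) i in decode E j , decode F k
  ; decode-encode = λ { {s , t} (p , q) → trans
      (cong (λ (j , k) → decode E j , decode F k) (remQuot-combine (encode E s) (encode F t)))
      (cong₂ _,_ (decode-encode E p) (decode-encode F q)) } }

Maybe-encoding : ∀ {S P} → Encoding S P → Encoding (Maybe S) (Maybe.All P)
Maybe-encoding {S} {P} E = record
  { size = suc (size E) ; encode = encode′ ; decode = decode′ ; decode-encode = inverse }
  where
  encode′ : Maybe S → Fin (suc (size E))
  encode′ nothing  = zero
  encode′ (just s) = suc (encode E s)
  decode′ : Fin (suc (size E)) → Maybe S
  decode′ zero    = nothing
  decode′ (suc i) = just (decode E i)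
  inverse : ∀ {s} → Maybe.All P s → decode′ (encode′ s) ≡ s
  inverse nothing  = refl
  inverse (just p) = cong just (decode-encode E p)

List-encoding : ∀ {S} → Encoding S U → ∀ m → Encoding (List S) (λ r → length r ≤ m)
List-encoding {S} E zero = record
  { size = 1 ; encode = λ _ → zero ; decode = λ _ → [] ; decode-encode = λ { {[]} _ → refl } }
List-encoding {S} E (suc m) = record
  { size = suc (size E * size F) ; encode = encode′ ; decode = decode′ ; decode-encode = inverse }
  where
  F = List-encoding E m
  encode′ : List S → Fin (suc (size E * size F))
  encode′ []      = zero
  encode′ (s ∷ r) = suc (combine (encode E s) (encode F r))
  decode′ : Fin (suc (size E * size F)) → List S
  decode′ zero    = []
  decode′ (suc i) = let (j , k) = remQuot (size F) i in decode E j ∷ decode F k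
  inverse : ∀ {r} → length r ≤ suc m → decode′ (encode′ r) ≡ r
  inverse {[]}    _         = refl
  inverse {s ∷ r} (s≤s |r|≤m) = trans
    (cong (λ (j , k) → decode E j ∷ decode F k) (remQuot-combine (encode E s) (encode F r)))
    (cong₂ _∷_ (decode-encode E tt) (decode-encode F |r|≤m))

-- A deterministic automaton over an arbitrary state type; it is finite because the
-- reachable states, which satisfy the invariant, are encoded in Fin (size encoding).
record Automaton (A : Set) : Set₁ where
  field
    State           : Set
    Invariant       : Pred State 0ℓ
    Final           : Pred State 0ℓ
    initial         : State
    next            : State → A → State
    final?          : Decidable Final
    initial-invariant : Invariant initial
    next-invariant  : ∀ {s} a → Invariant s → Invariant (next s a)
    encoding        : Encoding State Invariant

  run : State → List A → State
  run = foldl next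

  run-invariant : ∀ {s} w → Invariant s → Invariant (run s w)
  run-invariant []      i = i
  run-invariant (a ∷ w) i = run-invariant w (next-invariant a i)

  Recognises : Pred (List A) 0ℓ → Set
  Recognises L = ∀ w → L w ⇔ Final (run initial w)

open Automaton using (Recognises)

Recognisable : ∀ {A} → Pred (List A) 0ℓ → Set₁
Recognisable L = Σ (Automaton _) λ M → Recognises M L

does⇔ : ∀ {P : Set} (p? : Dec P) → does p? ≡ true ⇔ P
does⇔ (yes p) = mk⇔ (λ _ → p) (λ _ → refl)
does⇔ (no ¬p) = mk⇔ (λ ()) (λ p → contradiction p ¬p)

module _ {A : Set} (M : Automaton A) where
  open Automaton M

  toDFA : DFA A
  toDFA = record
    { states = size encoding
    ; start  = encode encoding initial
    ; δ      = λ i a → encode encoding (next (decode encoding i) a)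
    ; accept = λ i → does (final? (decode encoding i))
    }

  toDFA-run : ∀ {s} w → Invariant s →
              foldl (δ toDFA) (encode encoding s) w ≡ encode encoding (run s w)
  toDFA-run []      _ = refl
  toDFA-run (a ∷ w) i rewrite decode-encode encoding i = toDFA-run w (next-invariant a i)

  toDFA-accepts : ∀ w → Accepts toDFA w ⇔ Final (run initial w)
  toDFA-accepts w rewrite toDFA-run w initial-invariant
                        | decode-encode encoding (run-invariant w initial-invariant)
                        = does⇔ (final? (run initial w))

recognisable⇒regular : ∀ {A} {L : Pred (List A) 0ℓ} → Recognisable L → IsRegular L
recognisable⇒regular (M , M-recognises) =
  toDFA M , λ w → ⇔.trans (M-recognises w) (⇔.sym (toDFA-accepts M w))

module _ {A : Set} where

  recognisable-resp-≐ : {L L′ : Pred (List A) 0ℓ} → L ≐ L′ → Recognisable L → Recognisable L′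
  recognisable-resp-≐ (L⊆L′ , L′⊆L) (M , M-recognises) =
    M , λ w → ⇔.trans (mk⇔ L′⊆L L⊆L′) (M-recognises w)

  universal : Automaton A
  universal = record
    { State = ⊤ ; Invariant = U ; Final = U ; initial = tt ; next = λ _ _ → tt
    ; final? = λ _ → yes tt ; initial-invariant = tt ; next-invariant = λ _ _ → tt
    ; encoding = ⊤-encoding }

  U-recognisable : Recognisable {A} U
  U-recognisable = universal , λ _ → mk⇔ (λ _ → tt) (λ _ → tt)

  _⊗_ : Automaton A → Automaton A → Automaton A
  M ⊗ N = record
    { State = M.State × N.State
    ; Invariant = M.Invariant ⟨×⟩ N.Invariant
    ; Final = M.Final ⟨×⟩ N.Final
    ; initial = M.initial , N.initial
    ; next = λ (s , t) a → M.next s a , N.next t a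
    ; final? = λ (s , t) → M.final? s ×-dec N.final? t
    ; initial-invariant = M.initial-invariant , N.initial-invariant
    ; next-invariant = λ a (i , j) → M.next-invariant a i , N.next-invariant a j
    ; encoding = ×-encoding M.encoding N.encoding }
    where
    module M = Automaton M
    module N = Automaton N

  ⊗-run : ∀ (M N : Automaton A) s t w →
          Automaton.run (M ⊗ N) (s , t) w ≡ (Automaton.run M s w , Automaton.run N t w)
  ⊗-run M N s t []      = refl
  ⊗-run M N s t (a ∷ w) = ⊗-run M N (Automaton.next M s a) (Automaton.next N t a) w

  ∩-recognisable : {L L′ : Pred (List A) 0ℓ} → Recognisable L → Recognisable L′ → Recognisable (L ∩ L′)
  ∩-recognisable {L} {L′} (M , M-recognises) (N , N-recognises) = M ⊗ N , λ w →
    subst (λ st → (L ∩ L′) w ⇔ (Automaton.Final M ⟨×⟩ Automaton.Final N) st)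
          (sym (⊗-run M N _ _ w))
          (M-recognises w ×-⇔ N-recognises w)

  ⋂-recognisable : ∀ {k} {L : Fin k → Pred (List A) 0ℓ} →
                   (∀ i → Recognisable (L i)) → Recognisable (⋂ (Fin k) L)
  ⋂-recognisable {zero}  _ = recognisable-resp-≐ ((λ _ ()) , (λ _ → tt)) U-recognisable
  ⋂-recognisable {suc k} {L} R = recognisable-resp-≐ (⋂-split , ⋂-join)
                               (∩-recognisable (R zero) (⋂-recognisable (λ i → R (suc i))))
    where
    ⋂-split : ∀ {w} → (L zero ∩ ⋂ (Fin k) (λ i → L (suc i))) w → ⋂ (Fin (suc k)) L w
    ⋂-split (p , ps) zero    = p
    ⋂-split (p , ps) (suc i) = ps i
    ⋂-join : ∀ {w} → ⋂ (Fin (suc k)) L w → (L zero ∩ ⋂ (Fin k) (λ i → L (suc i))) w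
    ⋂-join ps = ps zero , λ i → ps (suc i)

  nonEmpty : Automaton A
  nonEmpty = record
    { State = Bool ; Invariant = U ; Final = _≡ true ; initial = false ; next = λ _ _ → true
    ; final? = Bool._≟ true ; initial-invariant = tt ; next-invariant = λ _ _ → tt
    ; encoding = Bool-encoding }

  nonEmpty-recognisable : Recognisable {A} NonEmpty
  nonEmpty-recognisable = nonEmpty , λ where
      []      → mk⇔ (λ []≢[] → contradiction refl []≢[]) (λ ())
      (a ∷ w) → mk⇔ (λ _ → run-true w) (λ _ ())
    where
    run-true : ∀ w → Automaton.run nonEmpty true w ≡ true
    run-true []      = refl
    run-true (_ ∷ w) = run-true w

module Permutations (n : ℕ) where

  IsPermutation : Pred (List (Fin n)) 0ℓ
  IsPermutation p = p ↭ allFin n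

  IsPermutation⇔ : ∀ {p} → IsPermutation p ⇔ (Unique p × ∀ x → x ∈ p)
  IsPermutation⇔ {p} = mk⇔
    (λ p↭ → Unique-resp-↭ (setoid (Fin n)) (↭⇒↭ₛ (↭-sym p↭)) (allFin⁺ n)
          , λ x → ∈-resp-↭ (↭-sym p↭) (∈-allFin x))
    (λ (p-unique , p-complete) → ∼bag⇒↭ (unique∧set⇒bag p-unique (allFin⁺ n)
          (mk⇔ (λ _ → ∈-allFin _) (λ _ → p-complete _))))

  isPermutation? : Decidable IsPermutation
  isPermutation? p = Dec.map (⇔.sym IsPermutation⇔) (unique? p ×-dec all? (_∈? p))
    where
    open DecUnique (Fin._≟_ {n}) using (unique?)
    open DecMembership (Fin._≟_ {n}) using (_∈?_)

  IsPermutation⇒length : ∀ {p} → IsPermutation p → length p ≡ n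
  IsPermutation⇒length p↭ = trans (↭-length p↭) (length-tabulate (λ x → x))

  ConcatOfPermutations : Pred (List (Fin n)) 0ℓ
  ConcatOfPermutations w = Σ (List (List (Fin n))) λ ps → All IsPermutation ps × concat ps ≡ w

  -- nothing: some completed block was not a permutation.
  Block : Set
  Block = Maybe (List (Fin n))

  extend : List (Fin n) → Block
  extend r with length r <? n
  ... | yes _ = just r
  ... | no  _ with isPermutation? r
  ...   | yes _ = just []
  ...   | no  _ = nothing

  data Extension (r : List (Fin n)) : Block → Set where
    growing  : Extension r (just r)
    complete : IsPermutation r → Extension r (just [])
    broken   : Extension r nothing

  extension : ∀ r → Extension r (extend r)
  extension r with length r <? n
  ... | yes _ = growing
  ... | no  _ with isPermutation? r
  ...   | yes r↭ = complete r↭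
  ...   | no  _  = broken

  extend-short : ∀ {r} → length r < n → extend r ≡ just r
  extend-short {r} |r|<n with length r <? n
  ... | yes _      = refl
  ... | no  |r|≮n = contradiction |r|<n |r|≮n

  extend-permutation : ∀ {r} → IsPermutation r → extend r ≡ just []
  extend-permutation {r} r↭ with length r <? n
  ... | yes |r|<n = contradiction (IsPermutation⇒length r↭) (<⇒≢ |r|<n)
  ... | no  _ with isPermutation? r
  ...   | yes _  = refl
  ...   | no  ¬r↭ = contradiction r↭ ¬r↭

  extend-bounded : ∀ r → Maybe.All (λ r′ → length r′ ≤ n) (extend r)
  extend-bounded r with length r <? n
  ... | yes |r|<n = just (<⇒≤ |r|<n)
  ... | no  _ with isPermutation? r
  ...   | yes _ = just z≤n
  ...   | no  _ = nothing

  blockStep : Block → Fin n → Block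
  blockStep nothing  a = nothing
  blockStep (just r) a = extend (r ∷ʳ a)

  blocks : Automaton (Fin n)
  blocks = record
    { State = Block
    ; Invariant = Maybe.All (λ r → length r ≤ n)
    ; Final = _≡ just []
    ; initial = just []
    ; next = blockStep
    ; final? = λ b → MaybeP.≡-dec (ListP.≡-dec Fin._≟_) b (just [])
    ; initial-invariant = just z≤n
    ; next-invariant = λ where
        a nothing  → nothing
        a (just {r} _) → extend-bounded (r ∷ʳ a)
    ; encoding = Maybe-encoding (List-encoding (Fin-encoding n) n)
    }
  open Automaton blocks using (run)
  open ≡-Reasoning

  run-nothing : ∀ w → run nothing w ≡ nothing
  run-nothing []      = refl
  run-nothing (_ ∷ w) = run-nothing w

  run-short : ∀ r q → length (r ++ q) < n → run (just r) q ≡ just (r ++ q)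
  run-short r []      _ = cong just (sym (++-identityʳ r))
  run-short r (a ∷ q) |rq|<n = begin
    run (extend (r ∷ʳ a)) q  ≡⟨ cong (λ b → run b q) (extend-short (≤-<-trans (length-++-≤ˡ (r ∷ʳ a)) |raq|<n)) ⟩
    run (just (r ∷ʳ a)) q    ≡⟨ run-short (r ∷ʳ a) q |raq|<n ⟩
    just ((r ∷ʳ a) ++ q)     ≡⟨ cong just (++-assoc r [ a ] q) ⟩
    just (r ++ a ∷ q)        ∎
    where
    |raq|<n : length ((r ∷ʳ a) ++ q) < n
    |raq|<n = subst (λ l → length l < n) (sym (++-assoc r [ a ] q)) |rq|<n

  run-permutation : ∀ {p} → IsPermutation p → run (just []) p ≡ just []
  run-permutation {p} p↭ with initLast p
  ... | []       = refl
  ... | i ∷ʳ′ a = begin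
    run (just []) (i ∷ʳ a)       ≡⟨ foldl-∷ʳ blockStep (just []) a i ⟩
    blockStep (run (just []) i) a ≡⟨ cong (λ b → blockStep b a) (run-short [] i |i|<n) ⟩
    extend (i ∷ʳ a)              ≡⟨ extend-permutation p↭ ⟩
    just []                      ∎
    where
    |i|<n : length i < n
    |i|<n = subst (length i <_) (trans (sym (length-++ i)) (IsPermutation⇒length p↭))
                  (m<m+n (length i) (s≤s z≤n))

  run-concat : ∀ {ps} → All IsPermutation ps → run (just []) (concat ps) ≡ just []
  run-concat []                    = refl
  run-concat {p ∷ ps} (p↭ ∷ ps↭) rewrite foldl-++ blockStep (just []) p (concat ps)
                                       | run-permutation p↭ = run-concat ps↭

  run-decompose : ∀ r₀ w {r} → run (just r₀) w ≡ just r →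
                  Σ (List (List (Fin n))) λ ps → All IsPermutation ps × r₀ ++ w ≡ concat ps ++ r
  run-decompose r₀ []      refl = [] , [] , ++-identityʳ r₀
  run-decompose r₀ (a ∷ w) h with extend (r₀ ∷ʳ a) | extension (r₀ ∷ʳ a)
  ... | _ | growing =
    let ps , ps↭ , eq = run-decompose (r₀ ∷ʳ a) w h
    in ps , ps↭ , trans (sym (++-assoc r₀ [ a ] w)) eq
  ... | _ | complete r₀a↭ =
    let ps , ps↭ , eq = run-decompose [] w h
    in (r₀ ∷ʳ a) ∷ ps , r₀a↭ ∷ ps↭ , (begin
      r₀ ++ a ∷ w              ≡⟨ ++-assoc r₀ [ a ] w ⟨
      (r₀ ∷ʳ a) ++ w           ≡⟨ cong ((r₀ ∷ʳ a) ++_) eq ⟩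
      (r₀ ∷ʳ a) ++ concat ps ++ _ ≡⟨ ++-assoc (r₀ ∷ʳ a) (concat ps) _ ⟨
      concat ((r₀ ∷ʳ a) ∷ ps) ++ _ ∎)
  ... | _ | broken = contradiction (trans (sym (run-nothing w)) h) λ ()

  blocks-recognises : Recognises blocks ConcatOfPermutations
  blocks-recognises w = mk⇔
    (λ (ps , ps↭ , eq) → subst (λ v → run (just []) v ≡ just []) eq (run-concat ps↭))
    (λ h → let ps , ps↭ , eq = run-decompose [] w h
           in ps , ps↭ , sym (trans eq (++-identityʳ (concat ps))))

  ConcatOfPermutations-recognisable : Recognisable ConcatOfPermutations
  ConcatOfPermutations-recognisable = blocks , blocks-recognises

  Permutational⇔ : ∀ {w} → NonEmpty w → IsPermutational w ⇔ ConcatOfPermutations w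
  Permutational⇔ {w} w≢[] = mk⇔
    (λ (ps , _ , ps↭ , eq) → ps , ps↭ , eq)
    (λ (ps , ps↭ , eq) → ps , ps≢[] eq , ps↭ , eq)
    where
    ps≢[] : ∀ {ps} → concat ps ≡ w → NonEmpty ps
    ps≢[] eq refl = w≢[] (sym eq)

foldl-∷ʳ-tracks : ∀ {A S : Set} (f : List A → S) (step : S → A → S) →
                  (∀ u a → f (u ∷ʳ a) ≡ step (f u) a) → ∀ w → foldl step (f []) w ≡ f w
foldl-∷ʳ-tracks f step f-∷ʳ = from []
  where
  from : ∀ u w → foldl step (f u) w ≡ f (u ++ w)
  from u []      = cong f (sym (++-identityʳ u))
  from u (a ∷ w) = trans (cong (λ s → foldl step s w) (sym (f-∷ʳ u a)))
                         (trans (from (u ∷ʳ a) w) (cong f (++-assoc u [ a ] w)))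

last-∷ʳ : ∀ {A : Set} (u : List A) a → last (u ∷ʳ a) ≡ just a
last-∷ʳ []          a = refl
last-∷ʳ (_ ∷ [])    a = refl
last-∷ʳ (_ ∷ b ∷ u) a = last-∷ʳ (b ∷ u) a

module _ {n : ℕ} where

  isSquare : Fin n → Fin n → Fin n → ℕ
  isSquare x a b = if does (a Fin.≟ x) ∧ does (b Fin.≟ x) then 1 else 0

  squareAfter : Fin n → Maybe (Fin n) → Fin n → ℕ
  squareAfter x l b = maybe′ (λ a → isSquare x a b) 0 l

  countSq-∷ʳ : ∀ x u b → countSq x (u ∷ʳ b) ≡ countSq x u + squareAfter x (last u) b
  countSq-∷ʳ x []          b = refl
  countSq-∷ʳ x (a ∷ [])    b = +-identityʳ (isSquare x a b)
  countSq-∷ʳ x (a ∷ c ∷ u) b = begin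
    isSquare x a c + countSq x ((c ∷ u) ∷ʳ b)                     ≡⟨ cong (isSquare x a c +_) (countSq-∷ʳ x (c ∷ u) b) ⟩
    isSquare x a c + (countSq x (c ∷ u) + squareAfter x (last (c ∷ u)) b) ≡⟨ +-assoc (isSquare x a c) _ _ ⟨
    countSq x (a ∷ c ∷ u) + squareAfter x (last (c ∷ u)) b        ∎
    where open ≡-Reasoning

  kept : Fin n → Fin n → Fin n → Bool
  kept x y a = does (a Fin.≟ x) ∨ does (a Fin.≟ y)

  restrict-∷ʳ : ∀ x y u a → restrict x y (u ∷ʳ a) ≡ restrict x y u ++ (if kept x y a then [ a ] else [])
  restrict-∷ʳ x y []      a = refl
  restrict-∷ʳ x y (z ∷ u) a with kept x y z
  ... | true  = cong (z ∷_) (restrict-∷ʳ x y u a)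
  ... | false = restrict-∷ʳ x y u a

saturate : ℕ → Fin 3
saturate 0             = zero
saturate 1             = suc zero
saturate (suc (suc _)) = suc (suc zero)

saturate-+ : ∀ k d → saturate (k + d) ≡ saturate (toℕ (saturate k) + d)
saturate-+ 0             d = refl
saturate-+ 1             d = refl
saturate-+ (suc (suc k)) d = refl

saturate-≤1 : ∀ k → toℕ (saturate k) ≤ 1 ⇔ k ≤ 1
saturate-≤1 0             = mk⇔ (λ _ → z≤n) (λ _ → z≤n)
saturate-≤1 1             = mk⇔ (λ _ → s≤s z≤n) (λ _ → s≤s z≤n)
saturate-≤1 (suc (suc k)) = mk⇔ (λ { (s≤s ()) }) (λ { (s≤s ()) })

_⇔-dec_ : ∀ {P Q : Set} → Dec P → Dec Q → Dec (P ⇔ Q)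
p? ⇔-dec q? = Dec.map (mk⇔ (λ (f , g) → mk⇔ f g) (λ P⇔Q → Equivalence.to P⇔Q , Equivalence.from P⇔Q))
                      ((p? →-dec q?) ×-dec (q? →-dec p?))

module AdjacencyCondition {n} (G : SimpleGraph n) (x y : Fin n) where

  squares : List (Fin n) → ℕ
  squares w = countSq x (restrict x y w) + countSq y (restrict x y w)

  RepresentsAdjacency : Pred (List (Fin n)) 0ℓ
  RepresentsAdjacency w = x ≢ y → (adj G x y ≡ true ⇔ squares w ≤ 1)

  Summary : Set
  Summary = Maybe (Fin n) × Fin 3

  summary : List (Fin n) → Summary
  summary w = last (restrict x y w) , saturate (squares w)

  summaryStep : Summary → Fin n → Summary
  summaryStep (l , c) a = if kept x y a
    then (just a , saturate (toℕ c + (squareAfter x l a + squareAfter y l a)))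
    else (l , c)

  summary-∷ʳ : ∀ w a → summary (w ∷ʳ a) ≡ summaryStep (summary w) a
  summary-∷ʳ w a rewrite restrict-∷ʳ x y w a with kept x y a
  ... | false = cong (λ r → last r , saturate (countSq x r + countSq y r)) (++-identityʳ (restrict x y w))
  ... | true  = cong₂ _,_ (last-∷ʳ r a) (begin
      saturate (countSq x (r ∷ʳ a) + countSq y (r ∷ʳ a))
        ≡⟨ cong saturate (cong₂ _+_ (countSq-∷ʳ x r a) (countSq-∷ʳ y r a)) ⟩
      saturate ((countSq x r + new-x) + (countSq y r + new-y))
        ≡⟨ cong saturate (interchange (countSq x r) new-x (countSq y r) new-y) ⟩
      saturate ((countSq x r + countSq y r) + (new-x + new-y))
        ≡⟨ saturate-+ (countSq x r + countSq y r) (new-x + new-y) ⟩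
      saturate (toℕ (saturate (countSq x r + countSq y r)) + (new-x + new-y)) ∎)
    where
    r = restrict x y w
    new-x = squareAfter x (last r) a
    new-y = squareAfter y (last r) a
    open ≡-Reasoning

  adjacency : Automaton (Fin n)
  adjacency = record
    { State = Summary
    ; Invariant = U
    ; Final = λ (_ , c) → x ≢ y → (adj G x y ≡ true ⇔ toℕ c ≤ 1)
    ; initial = summary []
    ; next = summaryStep
    ; final? = λ (_ , c) → ¬? (x Fin.≟ y) →-dec ((adj G x y Bool.≟ true) ⇔-dec (toℕ c ℕ.≤? 1))
    ; initial-invariant = tt
    ; next-invariant = λ _ _ → tt
    ; encoding = encoding-⊆ (λ {(l , _)} _ → Maybe.universal (λ _ → tt) l , tt)
                   (×-encoding (Maybe-encoding (Fin-encoding n)) (Fin-encoding 3))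
    }

  adjacency-recognises : Recognises adjacency RepresentsAdjacency
  adjacency-recognises w rewrite foldl-∷ʳ-tracks summary summaryStep summary-∷ʳ w = mk⇔
    (λ h x≢y → ⇔.trans (h x≢y) (⇔.sym (saturate-≤1 (squares w))))
    (λ h x≢y → ⇔.trans (h x≢y) (saturate-≤1 (squares w)))

  RepresentsAdjacency-recognisable : Recognisable RepresentsAdjacency
  RepresentsAdjacency-recognisable = adjacency , adjacency-recognises

open Permutations using (ConcatOfPermutations; ConcatOfPermutations-recognisable; Permutational⇔)
open AdjacencyCondition using (RepresentsAdjacency-recognisable)

permutational1-11-rep≐ : ∀ {n} (G : SimpleGraph n) →
  (ConcatOfPermutations n ∩ Is1-11-Rep G) ≐ IsPermutational1-11-Rep G
permutational1-11-rep≐ {n} G =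
  (λ (w-concat , w-rep) → Equivalence.from (Permutational⇔ n (proj₁ w-rep)) w-concat , w-rep) ,
  (λ (w-perm , w-rep) → Equivalence.to (Permutational⇔ n (proj₁ w-rep)) w-perm , w-rep)

mainTheorem9 : (n : ℕ) (G : SimpleGraph n) → IsRegular (IsPermutational1-11-Rep G)
mainTheorem9 n G = recognisable⇒regular (recognisable-resp-≐ (permutational1-11-rep≐ G)
  (∩-recognisable (ConcatOfPermutations-recognisable n)
  (∩-recognisable nonEmpty-recognisable
  (⋂-recognisable λ x → ⋂-recognisable λ y → RepresentsAdjacency-recognisable G x y))))
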